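{- Let $\mathcal{C}$ be the graph with vertex set $\{x_1,x_2,x_3,x_4,y_1,y_2,y_3\}$ and edge set $\{x_1x_2,x_2x_3,x_3x_4,x_4x_1,x_1y_1,x_2y_2,x_3y_3\}$. Let $G'$ be any graph, let $v\in V(G')$, and let $G$ be the graph obtained from the disjoint union of $G'$ and $\mathcal{C}$ by adding the edge $x_1v$. If $S$ is any $\gamma_{ID}$-set of $G$, then $\{x_1,x_2,x_3\}\subseteq S$. Moreover, if $S'$ is a $\gamma_{ID}$-set of $G'$, then $S'\cup\{x_1,x_2,x_3\}$ is an identifying code of $G$.
   Context: For a graph $G$, a set $S\subseteq V(G)$ is an identifying code if for every $v\in V(G)$ the set $I_S(v)=N[v]\cap S$ is nonempty and $I_S(u)\neq I_S(v)$ for all distinct $u,v\in V(G)$. $\gamma_{ID}(G)$ is the minimum cardinality of an identifying code, and a $\gamma_{ID}$-set is an identifying code of cardinality $\gamma_{ID}(G)$. -}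

module Defs where

open import Data.Nat using (ℕ; _+_; _≤_)
open import Data.Bool using (Bool; true; false; _∨_; _∧_)
open import Data.Fin using (Fin; zero; suc; splitAt; _↑ʳ_; _≟_)
open import Data.Fin.Subset using (Subset; _∈_; _∩_; _∪_; ⁅_⁆; ∣_∣; Nonempty; outside)
open import Data.Vec using (tabulate; lookup)
open import Data.Sum using (inj₁; inj₂)
open import Data.Product using (_×_)
open import Relation.Nullary using (¬_)
open import Relation.Nullary.Decidable using (⌊_⌋)
open import Relation.Binary.PropositionalEquality using (_≡_; _≢_)

Adj : ℕ → Set
Adj n = Fin n → Fin n → Bool

Symmetric : ∀ {n} → Adj n → Set
Symmetric {n} A = ∀ (u w : Fin n) → A u w ≡ A w u

Irreflexive : ∀ {n} → Adj n → Set
Irreflexive {n} A = ∀ (u : Fin n) → A u u ≡ false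

N[_]⟨_⟩ : ∀ {n} → Adj n → Fin n → Subset n
N[ A ]⟨ v ⟩ = tabulate (λ u → ⌊ u ≟ v ⌋ ∨ A v u)

I : ∀ {n} → Adj n → Subset n → Fin n → Subset n
I A S v = N[ A ]⟨ v ⟩ ∩ S

IsIdCode : ∀ {n} → Adj n → Subset n → Set
IsIdCode {n} A S =
  (∀ (v : Fin n) → Nonempty (I A S v)) ×
  (∀ (u v : Fin n) → u ≢ v → I A S u ≢ I A S v)

IsγIDSet : ∀ {n} → Adj n → Subset n → Set
IsγIDSet {n} A S = IsIdCode A S × (∀ (T : Subset n) → IsIdCode A T → ∣ S ∣ ≤ ∣ T ∣)

-- The graph 𝒞 on Fin 7 : x₁ = 0, x₂ = 1, x₃ = 2, x₄ = 3, y₁ = 4, y₂ = 5, y₃ = 6.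
-- Edges: x₁x₂, x₂x₃, x₃x₄, x₄x₁, x₁y₁, x₂y₂, x₃y₃.
edgeC : Fin 7 → Fin 7 → Bool
edgeC zero (suc zero) = true
edgeC (suc zero) (suc (suc zero)) = true
edgeC (suc (suc zero)) (suc (suc (suc zero))) = true
edgeC (suc (suc (suc zero))) zero = true
edgeC zero (suc (suc (suc (suc zero)))) = true
edgeC (suc zero) (suc (suc (suc (suc (suc zero))))) = true
edgeC (suc (suc zero)) (suc (suc (suc (suc (suc (suc zero)))))) = true
edgeC _ _ = false

adjC : Adj 7
adjC a b = edgeC a b ∨ edgeC b a

x₁ᶜ : Fin 7
x₁ᶜ = zero

-- G: disjoint union of G' (on Fin n, embedded as the first n vertices) and 𝒞
-- (embedded as the last 7 vertices via n ↑ʳ_), plus the edge x₁v.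
glue : ∀ {n} → Adj n → Fin n → Adj (n + 7)
glue {n} A v a b with splitAt n a | splitAt n b
... | inj₁ i | inj₁ j = A i j
... | inj₂ i | inj₂ j = adjC i j
... | inj₁ i | inj₂ j = ⌊ i ≟ v ⌋ ∧ ⌊ j ≟ x₁ᶜ ⌋
... | inj₂ i | inj₁ j = ⌊ i ≟ x₁ᶜ ⌋ ∧ ⌊ j ≟ v ⌋

X : ∀ n → Fin 7 → Fin (n + 7)
X n j = n ↑ʳ j

x₁ x₂ x₃ : ∀ n → Fin (n + 7)
x₁ n = X n zero
x₂ n = X n (suc zero)
x₃ n = X n (suc (suc zero))

liftS : ∀ {n} → Subset n → Subset (n + 7)
liftS {n} S = tabulate (λ a → f (splitAt n a))
  where
  open import Data.Sum using (_⊎_)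
  f : Fin n ⊎ Fin 7 → Bool
  f (inj₁ i) = lookup S i
  f (inj₂ _) = outside

module Submission where

-- Write V(G) = V(G') ⊎ V(𝒞), so that every subset T of V(G) is a concatenation
-- L ++ R with L ⊆ V(G') and R ⊆ V(𝒞).  The only edge between the two halves is
-- x₁v, hence every vertex a of G is one of: v, a vertex u ≠ v of G', or a vertex
-- c of 𝒞 (the view 'Place'), and the code I_T(a) splits as a left part (a trace
-- on L) followed by a right part (a trace on R), computed in 'code-split'.
--
-- Comparing the halves of these codes gives two general facts about L ++ R:
--   * sufficiency ('glue-identifies'): if L identifies G' away from v and R is
--     an identifying code of 𝒞 containing x₁ whose codes do not clash with the
--     trace {x₁} ∩ R of v, then L ++ R identifies G;
--   * necessity ('restrict-G′', 'restrict-𝒞', 'pendant-separated'): an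
--     identifying code L ++ R of G restricts to codes identifying G' away from v
--     and 𝒞 away from x₁, and R must also separate v when L does not dominate v.
-- A finite search over the 128 subsets of V(𝒞) shows that such an R with at
-- most 3 (resp. 4) elements contains {x₁,x₂,x₃}.  Since L ++ {x₁,x₂,x₃} (resp.
-- L ++ {x₁,x₂,x₃,y₁}) is again an identifying code of G, minimality of a
-- γ_ID-set bounds |R| accordingly, proving the first claim; the second claim is
-- sufficiency applied to L = S' and R = {x₁,x₂,x₃}.

open import Defs
open import Data.Nat using (ℕ; zero; suc; _+_; _≤_; _≤?_)
open import Data.Nat.Properties using (+-cancelˡ-≤)
open import Data.Bool using (true; false; _∧_; _∨_)
import Data.Bool.Properties as Bool
open import Data.Fin using (Fin; zero; suc; splitAt; _↑ˡ_; _↑ʳ_; _≟_)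
open import Data.Fin.Properties
  using (all?; suc-injective; splitAt-↑ˡ; splitAt-↑ʳ; join-splitAt; ↑ˡ-injective; ↑ʳ-injective)
open import Data.Fin.Subset
  using (Subset; inside; outside; _∈_; _∩_; _∪_; _⊆_; ⁅_⁆; ∣_∣; Nonempty; Empty; ⊥)
open import Data.Fin.Subset.Properties
  using (nonempty?; anySubset?; _⊆?_; Empty-unique; ∉⊥; x∈⁅x⁆; x∈p∩q⁺;
         ∩-zeroˡ; ∪-identityˡ; ∪-identityʳ)
open import Data.Vec using (Vec; []; _∷_; _++_; lookup; tabulate; here; there)
import Data.Vec as Vec
open import Data.Vec.Properties
  using (≡-dec; lookup∘tabulate; tabulate∘lookup; tabulate-cong; lookup-replicate;
         zipWith-++; ++-injectiveˡ; ++-injectiveʳ)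
open import Data.Sum using (_⊎_; inj₁; inj₂)
open import Data.Product using (_×_; _,_; ∃; proj₁)
open import Function using (_∘_)
open import Relation.Nullary using (¬_; Dec; yes; no; contradiction)
open import Relation.Nullary.Decidable
  using (⌊_⌋; _×-dec_; _→-dec_; ¬?; isYes≗does; dec-true; dec-false; decidable-stable;
         toWitness; toWitnessFalse)
open import Relation.Binary.PropositionalEquality
  using (_≡_; _≢_; refl; sym; trans; cong; cong₂; subst; subst₂; ≢-sym; module ≡-Reasoning)

open ≡-Reasoning

vec-ext : ∀ {A : Set} {k} {xs ys : Vec A k} → (∀ i → lookup xs i ≡ lookup ys i) → xs ≡ ys
vec-ext {xs = xs} {ys} h =
  trans (sym (tabulate∘lookup xs)) (trans (tabulate-cong h) (tabulate∘lookup ys))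

++-ext : ∀ {A : Set} {m k} (V : Vec A (m + k)) (X : Vec A m) (Y : Vec A k) →
  (∀ i → lookup V (i ↑ˡ k) ≡ lookup X i) → (∀ j → lookup V (m ↑ʳ j) ≡ lookup Y j) →
  V ≡ X ++ Y
++-ext V [] Y _ right = vec-ext right
++-ext (w ∷ V) (x ∷ X) Y left right =
  cong₂ _∷_ (left zero) (++-ext V X Y (left ∘ suc) right)

∣++∣ : ∀ {m k} (X : Subset m) (Y : Subset k) → ∣ X ++ Y ∣ ≡ ∣ X ∣ + ∣ Y ∣
∣++∣ [] Y = refl
∣++∣ (inside ∷ X) Y = cong suc (∣++∣ X Y)
∣++∣ (outside ∷ X) Y = ∣++∣ X Y

∩-++ : ∀ {m k} (X X′ : Subset m) (Y Y′ : Subset k) →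
  (X ++ Y) ∩ (X′ ++ Y′) ≡ (X ∩ X′) ++ (Y ∩ Y′)
∩-++ X X′ Y Y′ = zipWith-++ _∧_ X Y X′ Y′

∪-++ : ∀ {m k} (X X′ : Subset m) (Y Y′ : Subset k) →
  (X ++ Y) ∪ (X′ ++ Y′) ≡ (X ∪ X′) ++ (Y ∪ Y′)
∪-++ X X′ Y Y′ = zipWith-++ _∨_ X Y X′ Y′

⌊⌋-true : ∀ {P : Set} (p? : Dec P) → P → ⌊ p? ⌋ ≡ true
⌊⌋-true p? p = trans (isYes≗does p?) (dec-true p? p)

⌊⌋-false : ∀ {P : Set} (p? : Dec P) → ¬ P → ⌊ p? ⌋ ≡ false
⌊⌋-false p? ¬p = trans (isYes≗does p?) (dec-false p? ¬p)

↑ˡ≢↑ʳ : ∀ {m k} (i : Fin m) (j : Fin k) → i ↑ˡ k ≢ m ↑ʳ j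
↑ˡ≢↑ʳ {m} {k} i j eq
  with trans (sym (splitAt-↑ˡ m i k)) (trans (cong (splitAt m) eq) (splitAt-↑ʳ m k j))
... | ()

≟-injective : ∀ {a b} (f : Fin a → Fin b) → (∀ x y → f x ≡ f y → x ≡ y) →
  ∀ x y → ⌊ f x ≟ f y ⌋ ≡ ⌊ x ≟ y ⌋
≟-injective f f-inj x y with x ≟ y
... | yes refl = ⌊⌋-true (f x ≟ f x) refl
... | no x≢y = ⌊⌋-false (f x ≟ f y) (x≢y ∘ f-inj x y)

lookup-⁅⁆ : ∀ {k} (x y : Fin k) → lookup ⁅ x ⁆ y ≡ ⌊ y ≟ x ⌋
lookup-⁅⁆ zero zero = refl
lookup-⁅⁆ zero (suc y) = lookup-replicate y outside
lookup-⁅⁆ (suc x) zero = refl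
lookup-⁅⁆ (suc x) (suc y) =
  trans (lookup-⁅⁆ x y) (sym (≟-injective suc (λ _ _ → suc-injective) y x))

∈-++⁺ʳ : ∀ {m k} {X : Subset m} {Y : Subset k} {j} → j ∈ Y → (m ↑ʳ j) ∈ X ++ Y
∈-++⁺ʳ {X = []} j∈Y = j∈Y
∈-++⁺ʳ {X = _ ∷ X} j∈Y = there (∈-++⁺ʳ {X = X} j∈Y)

Nonempty-++⁺ˡ : ∀ {m k} {X : Subset m} (Y : Subset k) → Nonempty X → Nonempty (X ++ Y)
Nonempty-++⁺ˡ {X = _ ∷ X} Y (zero , here) = zero , here
Nonempty-++⁺ˡ {X = _ ∷ X} Y (suc i , there i∈X) =
  let j , j∈ = Nonempty-++⁺ˡ Y (i , i∈X) in suc j , there j∈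

Nonempty-++⁺ʳ : ∀ {m k} (X : Subset m) {Y : Subset k} → Nonempty Y → Nonempty (X ++ Y)
Nonempty-++⁺ʳ X (j , j∈Y) = _ , ∈-++⁺ʳ {X = X} j∈Y

Nonempty-++⁻ : ∀ {m k} (X : Subset m) {Y : Subset k} → Nonempty (X ++ Y) → Nonempty X ⊎ Nonempty Y
Nonempty-++⁻ [] ne = inj₂ ne
Nonempty-++⁻ (inside ∷ X) ne = inj₁ (zero , here)
Nonempty-++⁻ (outside ∷ X) (suc i , there i∈) with Nonempty-++⁻ X (i , i∈)
... | inj₁ (j , j∈X) = inj₁ (suc j , there j∈X)
... | inj₂ ne = inj₂ ne

⊥∩-empty : ∀ {k} (X : Subset k) → Empty (⊥ ∩ X)
⊥∩-empty X rewrite ∩-zeroˡ X = λ (_ , x∈⊥) → ∉⊥ x∈⊥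

nonempty≢empty : ∀ {k} {X Y : Subset k} → Nonempty X → Empty Y → X ≢ Y
nonempty≢empty ne em X≡Y = em (subst Nonempty X≡Y ne)

≢-++ˡ : ∀ {m k} {X X′ : Subset m} {Y Y′ : Subset k} → X ≢ X′ → X ++ Y ≢ X′ ++ Y′
≢-++ˡ {X = X} {X′} X≢X′ eq = X≢X′ (++-injectiveˡ X X′ eq)

≢-++ʳ : ∀ {m k} {X X′ : Subset m} {Y Y′ : Subset k} → Y ≢ Y′ → X ++ Y ≢ X′ ++ Y′
≢-++ʳ {X = X} {X′} Y≢Y′ eq = Y≢Y′ (++-injectiveʳ X X′ eq)

_≟ˢ_ : ∀ {k} (X Y : Subset k) → Dec (X ≡ Y)
_≟ˢ_ = ≡-dec Bool._≟_

IdentifiesExcept : ∀ {n} → Adj n → Subset n → Fin n → Set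
IdentifiesExcept {n} A S x =
  (∀ (u : Fin n) → u ≢ x → Nonempty (I A S u)) ×
  (∀ (u w : Fin n) → u ≢ x → w ≢ x → u ≢ w → I A S u ≢ I A S w)

IsIdCode⇒IdentifiesExcept : ∀ {n} {A : Adj n} {S : Subset n} (x : Fin n) →
  IsIdCode A S → IdentifiesExcept A S x
IsIdCode⇒IdentifiesExcept x (dom , sep) = (λ u _ → dom u) , (λ u w _ _ → sep u w)

-- Both notions are decidable, which settles the finite questions about 𝒞.
isIdCode? : ∀ {n} (A : Adj n) (S : Subset n) → Dec (IsIdCode A S)
isIdCode? A S =
  all? (λ u → nonempty? (I A S u)) ×-dec
  all? (λ u → all? λ w → ¬? (u ≟ w) →-dec ¬? (I A S u ≟ˢ I A S w))

identifiesExcept? : ∀ {n} (A : Adj n) (S : Subset n) (x : Fin n) → Dec (IdentifiesExcept A S x)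
identifiesExcept? A S x =
  all? (λ u → ¬? (u ≟ x) →-dec nonempty? (I A S u)) ×-dec
  all? (λ u → all? λ w → ¬? (u ≟ x) →-dec ¬? (w ≟ x) →-dec ¬? (u ≟ w) →-dec
                           ¬? (I A S u ≟ˢ I A S w))

lookup-N : ∀ {k} (B : Adj k) (a b : Fin k) → lookup N[ B ]⟨ a ⟩ b ≡ ⌊ b ≟ a ⌋ ∨ B a b
lookup-N B a b = lookup∘tabulate _ b

-- The trace on R ⊆ V(𝒞) of a vertex whose only neighbour in 𝒞 is x₁.
pendantTrace : Subset 7 → Subset 7
pendantTrace R = ⁅ x₁ᶜ ⁆ ∩ R

-- R also separates such a pendant vertex from the vertices c ≠ x₁ of 𝒞.
PendantSeparated : Subset 7 → Set
PendantSeparated R =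
  Nonempty (pendantTrace R) × (∀ c → c ≢ x₁ᶜ → pendantTrace R ≢ I adjC R c)

pendantSeparated? : (R : Subset 7) → Dec (PendantSeparated R)
pendantSeparated? R =
  nonempty? (pendantTrace R) ×-dec
  all? (λ c → ¬? (c ≟ x₁ᶜ) →-dec ¬? (pendantTrace R ≟ˢ I adjC R c))

-- {x₁, x₂, x₃} and {x₁, x₂, x₃, y₁}.
core core⁺ : Subset 7
core = inside ∷ inside ∷ inside ∷ outside ∷ outside ∷ outside ∷ outside ∷ []
core⁺ = inside ∷ inside ∷ inside ∷ outside ∷ inside ∷ outside ∷ outside ∷ []

-- Both are identifying codes of 𝒞; the code of y₁ under core is {x₁}, the
-- trace of a pendant vertex, and no code under core⁺ is such a trace.
core-identifies : IsIdCode adjC core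
core-identifies = toWitness {a? = isIdCode? adjC core} _

core⁺-identifies : IsIdCode adjC core⁺
core⁺-identifies = toWitness {a? = isIdCode? adjC core⁺} _

core-clash : ∀ c → pendantTrace core ≡ I adjC core c → c ≢ x₁ᶜ
core-clash =
  toWitness {a? = all? λ c → (pendantTrace core ≟ˢ I adjC core c) →-dec ¬? (c ≟ x₁ᶜ)} _

core⁺-no-clash : ∀ c → pendantTrace core⁺ ≢ I adjC core⁺ c
core⁺-no-clash = toWitness {a? = all? λ c → ¬? (pendantTrace core⁺ ≟ˢ I adjC core⁺ c)} _

small-codes-contain-core : ∀ R → IdentifiesExcept adjC R x₁ᶜ → ∣ R ∣ ≤ 3 → core ⊆ R
small-codes-contain-core R identifies small =
  decidable-stable (core ⊆? R) λ core⊈R → no-counterexample (R , small , core⊈R , identifies)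
  where
  no-counterexample : ¬ ∃ λ R → ∣ R ∣ ≤ 3 × ¬ core ⊆ R × IdentifiesExcept adjC R x₁ᶜ
  no-counterexample = toWitnessFalse {a? = anySubset? λ R →
    ∣ R ∣ ≤? 3 ×-dec ¬? (core ⊆? R) ×-dec identifiesExcept? adjC R x₁ᶜ} _

small-pendant-codes-contain-core : ∀ R → IdentifiesExcept adjC R x₁ᶜ → PendantSeparated R →
  ∣ R ∣ ≤ 4 → core ⊆ R
small-pendant-codes-contain-core R identifies separated small =
  decidable-stable (core ⊆? R) λ core⊈R →
    no-counterexample (R , small , core⊈R , identifies , separated)
  where
  no-counterexample : ¬ ∃ λ R → ∣ R ∣ ≤ 4 × ¬ core ⊆ R × IdentifiesExcept adjC R x₁ᶜ ×
                                PendantSeparated R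
  no-counterexample = toWitnessFalse {a? = anySubset? λ R →
    ∣ R ∣ ≤? 4 ×-dec ¬? (core ⊆? R) ×-dec identifiesExcept? adjC R x₁ᶜ ×-dec
    pendantSeparated? R} _

module Glued {n : ℕ} (A : Adj n) (v : Fin n) where

  G : Adj (n + 7)
  G = glue A v

  glue-ˡˡ : ∀ u i → G (u ↑ˡ 7) (i ↑ˡ 7) ≡ A u i
  glue-ˡˡ u i rewrite splitAt-↑ˡ n u 7 | splitAt-↑ˡ n i 7 = refl

  glue-ˡʳ : ∀ u j → G (u ↑ˡ 7) (n ↑ʳ j) ≡ ⌊ u ≟ v ⌋ ∧ ⌊ j ≟ x₁ᶜ ⌋
  glue-ˡʳ u j rewrite splitAt-↑ˡ n u 7 | splitAt-↑ʳ n 7 j = refl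

  glue-ʳˡ : ∀ c i → G (n ↑ʳ c) (i ↑ˡ 7) ≡ ⌊ c ≟ x₁ᶜ ⌋ ∧ ⌊ i ≟ v ⌋
  glue-ʳˡ c i rewrite splitAt-↑ʳ n 7 c | splitAt-↑ˡ n i 7 = refl

  glue-ʳʳ : ∀ c j → G (n ↑ʳ c) (n ↑ʳ j) ≡ adjC c j
  glue-ʳʳ c j rewrite splitAt-↑ʳ n 7 c | splitAt-↑ʳ n 7 j = refl

  N-ˡˡ : ∀ u i → lookup N[ G ]⟨ u ↑ˡ 7 ⟩ (i ↑ˡ 7) ≡ lookup N[ A ]⟨ u ⟩ i
  N-ˡˡ u i = begin
    lookup N[ G ]⟨ u ↑ˡ 7 ⟩ (i ↑ˡ 7)           ≡⟨ lookup-N G (u ↑ˡ 7) (i ↑ˡ 7) ⟩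
    ⌊ i ↑ˡ 7 ≟ u ↑ˡ 7 ⌋ ∨ G (u ↑ˡ 7) (i ↑ˡ 7)
      ≡⟨ cong₂ _∨_ (≟-injective (_↑ˡ 7) (↑ˡ-injective 7) i u) (glue-ˡˡ u i) ⟩
    ⌊ i ≟ u ⌋ ∨ A u i                          ≡⟨ lookup-N A u i ⟨
    lookup N[ A ]⟨ u ⟩ i                       ∎

  N-ˡʳ : ∀ u j → lookup N[ G ]⟨ u ↑ˡ 7 ⟩ (n ↑ʳ j) ≡ ⌊ u ≟ v ⌋ ∧ ⌊ j ≟ x₁ᶜ ⌋
  N-ˡʳ u j = trans (lookup-N G (u ↑ˡ 7) (n ↑ʳ j))
    (cong₂ _∨_ (⌊⌋-false (n ↑ʳ j ≟ u ↑ˡ 7) (≢-sym (↑ˡ≢↑ʳ u j))) (glue-ˡʳ u j))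

  N-ʳˡ : ∀ c i → lookup N[ G ]⟨ n ↑ʳ c ⟩ (i ↑ˡ 7) ≡ ⌊ c ≟ x₁ᶜ ⌋ ∧ ⌊ i ≟ v ⌋
  N-ʳˡ c i = trans (lookup-N G (n ↑ʳ c) (i ↑ˡ 7))
    (cong₂ _∨_ (⌊⌋-false (i ↑ˡ 7 ≟ n ↑ʳ c) (↑ˡ≢↑ʳ i c)) (glue-ʳˡ c i))

  N-ʳʳ : ∀ c j → lookup N[ G ]⟨ n ↑ʳ c ⟩ (n ↑ʳ j) ≡ lookup N[ adjC ]⟨ c ⟩ j
  N-ʳʳ c j = begin
    lookup N[ G ]⟨ n ↑ʳ c ⟩ (n ↑ʳ j)           ≡⟨ lookup-N G (n ↑ʳ c) (n ↑ʳ j) ⟩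
    ⌊ n ↑ʳ j ≟ n ↑ʳ c ⌋ ∨ G (n ↑ʳ c) (n ↑ʳ j)
      ≡⟨ cong₂ _∨_ (≟-injective (n ↑ʳ_) (↑ʳ-injective n) j c) (glue-ʳʳ c j) ⟩
    ⌊ j ≟ c ⌋ ∨ adjC c j                       ≡⟨ lookup-N adjC c j ⟨
    lookup N[ adjC ]⟨ c ⟩ j                    ∎

  data Place : Fin (n + 7) → Set where
    atV : Place (v ↑ˡ 7)
    inG′ : ∀ u → u ≢ v → Place (u ↑ˡ 7)
    in𝒞 : ∀ c → Place (n ↑ʳ c)

  place : ∀ a → Place a
  place a with splitAt n a | join-splitAt n 7 a
  ... | inj₂ c | refl = in𝒞 c
  ... | inj₁ u | refl with u ≟ v
  ...   | yes refl = atV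
  ...   | no u≢v = inG′ u u≢v

  link : Fin 7 → Subset n
  link zero = ⁅ v ⁆
  link (suc _) = ⊥

  link-away : ∀ c → c ≢ x₁ᶜ → link c ≡ ⊥
  link-away zero c≢x₁ = contradiction refl c≢x₁
  link-away (suc _) _ = refl

  leftN : ∀ {a} → Place a → Subset n
  leftN atV = N[ A ]⟨ v ⟩
  leftN (inG′ u _) = N[ A ]⟨ u ⟩
  leftN (in𝒞 c) = link c

  rightN : ∀ {a} → Place a → Subset 7
  rightN atV = ⁅ x₁ᶜ ⁆
  rightN (inG′ _ _) = ⊥
  rightN (in𝒞 c) = N[ adjC ]⟨ c ⟩

  nbhd-split : ∀ {a} (p : Place a) → N[ G ]⟨ a ⟩ ≡ leftN p ++ rightN p
  nbhd-split atV = ++-ext N[ G ]⟨ v ↑ˡ 7 ⟩ N[ A ]⟨ v ⟩ ⁅ x₁ᶜ ⁆ (N-ˡˡ v) λ j → begin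
    lookup N[ G ]⟨ v ↑ˡ 7 ⟩ (n ↑ʳ j)  ≡⟨ N-ˡʳ v j ⟩
    ⌊ v ≟ v ⌋ ∧ ⌊ j ≟ x₁ᶜ ⌋           ≡⟨ cong (_∧ ⌊ j ≟ x₁ᶜ ⌋) (⌊⌋-true (v ≟ v) refl) ⟩
    ⌊ j ≟ x₁ᶜ ⌋                       ≡⟨ lookup-⁅⁆ x₁ᶜ j ⟨
    lookup ⁅ x₁ᶜ ⁆ j                  ∎
  nbhd-split (inG′ u u≢v) = ++-ext N[ G ]⟨ u ↑ˡ 7 ⟩ N[ A ]⟨ u ⟩ ⊥ (N-ˡˡ u) λ j → begin
    lookup N[ G ]⟨ u ↑ˡ 7 ⟩ (n ↑ʳ j)  ≡⟨ N-ˡʳ u j ⟩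
    ⌊ u ≟ v ⌋ ∧ ⌊ j ≟ x₁ᶜ ⌋           ≡⟨ cong (_∧ ⌊ j ≟ x₁ᶜ ⌋) (⌊⌋-false (u ≟ v) u≢v) ⟩
    false                             ≡⟨ lookup-replicate j outside ⟨
    lookup ⊥ j                        ∎
  nbhd-split (in𝒞 c) = ++-ext N[ G ]⟨ n ↑ʳ c ⟩ (link c) N[ adjC ]⟨ c ⟩
    (λ i → trans (N-ʳˡ c i) (link-entry c i)) (N-ʳʳ c)
    where
    link-entry : ∀ c i → ⌊ c ≟ x₁ᶜ ⌋ ∧ ⌊ i ≟ v ⌋ ≡ lookup (link c) i
    link-entry zero i = sym (lookup-⁅⁆ v i)
    link-entry (suc c) i = sym (lookup-replicate i outside)

  module _ (L : Subset n) (R : Subset 7) where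

    code-split : ∀ {a} (p : Place a) → I G (L ++ R) a ≡ (leftN p ∩ L) ++ (rightN p ∩ R)
    code-split p = trans (cong (_∩ (L ++ R)) (nbhd-split p)) (∩-++ (leftN p) L (rightN p) R)

    unlinked : ∀ c → c ≢ x₁ᶜ → link c ∩ L ≡ ⊥ ∩ L
    unlinked c c≢x₁ = cong (_∩ L) (link-away c c≢x₁)

    PendantSafe : Set
    PendantSafe = ∀ c → pendantTrace R ≡ I adjC R c → c ≢ x₁ᶜ × Nonempty (I A L v)

    glue-identifies : IdentifiesExcept A L v → x₁ᶜ ∈ R → IsIdCode adjC R → PendantSafe →
      IsIdCode G (L ++ R)
    glue-identifies (domL , sepL) x₁∈R (domR , sepR) safe = dominated , separated
      where
      Code : ∀ {a} → Place a → Subset (n + 7)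
      Code p = (leftN p ∩ L) ++ (rightN p ∩ R)

      pendant-seen : Nonempty (pendantTrace R)
      pendant-seen = x₁ᶜ , x∈p∩q⁺ (x∈⁅x⁆ x₁ᶜ , x₁∈R)

      code-nonempty : ∀ {a} (p : Place a) → Nonempty (Code p)
      code-nonempty atV = Nonempty-++⁺ʳ (I A L v) pendant-seen
      code-nonempty (inG′ u u≢v) = Nonempty-++⁺ˡ (⊥ ∩ R) (domL u u≢v)
      code-nonempty (in𝒞 c) = Nonempty-++⁺ʳ (link c ∩ L) (domR c)

      -- v differs from u ≠ v on R, and from c ∈ 𝒞 on R or (by safety) on L.
      v≢G′ : ∀ u u≢v → Code atV ≢ Code (inG′ u u≢v)
      v≢G′ _ _ = ≢-++ʳ (nonempty≢empty pendant-seen (⊥∩-empty R))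

      v≢𝒞 : ∀ c → Code atV ≢ Code (in𝒞 c)
      v≢𝒞 c same with safe c (++-injectiveʳ (I A L v) (link c ∩ L) same)
      ... | c≢x₁ , v-seen =
        nonempty≢empty v-seen (subst Empty (sym (unlinked c c≢x₁)) (⊥∩-empty L))
                       (++-injectiveˡ (I A L v) (link c ∩ L) same)

      G′≢𝒞 : ∀ u u≢v c → Code (inG′ u u≢v) ≢ Code (in𝒞 c)
      G′≢𝒞 _ _ c = ≢-++ʳ (≢-sym (nonempty≢empty (domR c) (⊥∩-empty R)))

      code-distinct : ∀ {a a′} (p : Place a) (q : Place a′) → a ≢ a′ → Code p ≢ Code q
      code-distinct atV atV a≢a′ = contradiction refl a≢a′
      code-distinct atV (inG′ u u≢v) _ = v≢G′ u u≢v
      code-distinct atV (in𝒞 c) _ = v≢𝒞 c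
      code-distinct (inG′ u u≢v) atV _ = ≢-sym (v≢G′ u u≢v)
      code-distinct (inG′ u u≢v) (inG′ w w≢v) a≢a′ =
        ≢-++ˡ (sepL u w u≢v w≢v (a≢a′ ∘ cong (_↑ˡ 7)))
      code-distinct (inG′ u u≢v) (in𝒞 c) _ = G′≢𝒞 u u≢v c
      code-distinct (in𝒞 c) atV _ = ≢-sym (v≢𝒞 c)
      code-distinct (in𝒞 c) (inG′ u u≢v) _ = ≢-sym (G′≢𝒞 u u≢v c)
      code-distinct (in𝒞 c) (in𝒞 d) a≢a′ = ≢-++ʳ (sepR c d (a≢a′ ∘ cong (n ↑ʳ_)))

      dominated : ∀ a → Nonempty (I G (L ++ R) a)
      dominated a = subst Nonempty (sym (code-split (place a))) (code-nonempty (place a))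

      separated : ∀ a a′ → a ≢ a′ → I G (L ++ R) a ≢ I G (L ++ R) a′
      separated a a′ a≢a′ same = code-distinct (place a) (place a′) a≢a′
        (trans (sym (code-split (place a))) (trans same (code-split (place a′))))

    restrict-G′ : IsIdCode G (L ++ R) → IdentifiesExcept A L v
    restrict-G′ (dom , sep) = dominated , separated
      where
      dominated : ∀ u → u ≢ v → Nonempty (I A L u)
      dominated u u≢v
        with Nonempty-++⁻ (I A L u) (subst Nonempty (code-split (inG′ u u≢v)) (dom (u ↑ˡ 7)))
      ... | inj₁ seen = seen
      ... | inj₂ seenʳ = contradiction seenʳ (⊥∩-empty R)

      separated : ∀ u w → u ≢ v → w ≢ v → u ≢ w → I A L u ≢ I A L w
      separated u w u≢v w≢v u≢w same = sep (u ↑ˡ 7) (w ↑ˡ 7) (u≢w ∘ ↑ˡ-injective 7 u w) (begin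
        I G (L ++ R) (u ↑ˡ 7)  ≡⟨ code-split (inG′ u u≢v) ⟩
        I A L u ++ (⊥ ∩ R)     ≡⟨ cong (_++ (⊥ ∩ R)) same ⟩
        I A L w ++ (⊥ ∩ R)     ≡⟨ code-split (inG′ w w≢v) ⟨
        I G (L ++ R) (w ↑ˡ 7)  ∎)

    restrict-𝒞 : IsIdCode G (L ++ R) → IdentifiesExcept adjC R x₁ᶜ
    restrict-𝒞 (dom , sep) = dominated , separated
      where
      dominated : ∀ c → c ≢ x₁ᶜ → Nonempty (I adjC R c)
      dominated c c≢x₁
        with Nonempty-++⁻ (link c ∩ L) (subst Nonempty (code-split (in𝒞 c)) (dom (n ↑ʳ c)))
      ... | inj₁ seenˡ = contradiction seenˡ (subst Empty (sym (unlinked c c≢x₁)) (⊥∩-empty L))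
      ... | inj₂ seen = seen

      separated : ∀ c d → c ≢ x₁ᶜ → d ≢ x₁ᶜ → c ≢ d → I adjC R c ≢ I adjC R d
      separated c d c≢x₁ d≢x₁ c≢d same = sep (n ↑ʳ c) (n ↑ʳ d) (c≢d ∘ ↑ʳ-injective n c d) (begin
        I G (L ++ R) (n ↑ʳ c)         ≡⟨ code-split (in𝒞 c) ⟩
        (link c ∩ L) ++ I adjC R c    ≡⟨ cong₂ _++_ (unlinked c c≢x₁) same ⟩
        (⊥ ∩ L) ++ I adjC R d         ≡⟨ cong (_++ I adjC R d) (unlinked d d≢x₁) ⟨
        (link d ∩ L) ++ I adjC R d    ≡⟨ code-split (in𝒞 d) ⟨
        I G (L ++ R) (n ↑ʳ d)         ∎)

    pendant-separated : IsIdCode G (L ++ R) → Empty (I A L v) → PendantSeparated R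
    pendant-separated (dom , sep) v-unseen = dominated , separated
      where
      dominated : Nonempty (pendantTrace R)
      dominated with Nonempty-++⁻ (I A L v) (subst Nonempty (code-split atV) (dom (v ↑ˡ 7)))
      ... | inj₁ seenˡ = contradiction seenˡ v-unseen
      ... | inj₂ seen = seen

      separated : ∀ c → c ≢ x₁ᶜ → pendantTrace R ≢ I adjC R c
      separated c c≢x₁ same = sep (v ↑ˡ 7) (n ↑ʳ c) (↑ˡ≢↑ʳ v c) (begin
        I G (L ++ R) (v ↑ˡ 7)         ≡⟨ code-split atV ⟩
        I A L v ++ pendantTrace R     ≡⟨ cong₂ _++_ (Empty-unique v-unseen) same ⟩
        ⊥ ++ I adjC R c               ≡⟨ cong (_++ I adjC R c) (∩-zeroˡ L) ⟨
        (⊥ ∩ L) ++ I adjC R c         ≡⟨ cong (_++ I adjC R c) (unlinked c c≢x₁) ⟨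
        (link c ∩ L) ++ I adjC R c    ≡⟨ code-split (in𝒞 c) ⟨
        I G (L ++ R) (n ↑ʳ c)         ∎)

  γ-bound : ∀ (L : Subset n) (R R′ : Subset 7) → IsγIDSet G (L ++ R) → IsIdCode G (L ++ R′) →
    ∣ R ∣ ≤ ∣ R′ ∣
  γ-bound L R R′ (_ , minimal) code′ =
    +-cancelˡ-≤ ∣ L ∣ _ _ (subst₂ _≤_ (∣++∣ L R) (∣++∣ L R′) (minimal (L ++ R′) code′))

  -- The 𝒞-part of a γ_ID-set of G contains x₁, x₂, x₃: otherwise replacing it by
  -- {x₁,x₂,x₃} (when L dominates v) or {x₁,x₂,x₃,y₁} (when it does not) gives a
  -- smaller identifying code.
  core-in-γ-set : ∀ (L : Subset n) (R : Subset 7) → IsγIDSet G (L ++ R) → core ⊆ R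
  core-in-γ-set L R γ@(code , _) with nonempty? (I A L v)
  ... | yes v-seen = small-codes-contain-core R (restrict-𝒞 L R code)
    (γ-bound L R core γ (glue-identifies L core (restrict-G′ L R code) here core-identifies
      λ c clash → core-clash c clash , v-seen))
  ... | no v-unseen = small-pendant-codes-contain-core R (restrict-𝒞 L R code)
    (pendant-separated L R code v-unseen)
    (γ-bound L R core⁺ γ (glue-identifies L core⁺ (restrict-G′ L R code) here core⁺-identifies
      λ c clash → contradiction clash (core⁺-no-clash c)))

-- Reads off an entry of a tabulated vector with g inferred from V; this is how
-- liftS is unfolded, since its defining function is local to a where block.
lookup-tabulated : ∀ {A : Set} {k} (V : Vec A k) {g : Fin k → A} → V ≡ tabulate g →
  ∀ a → lookup V a ≡ g a
lookup-tabulated V refl a = lookup∘tabulate _ a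

liftS-++ : ∀ {n} (S : Subset n) → liftS S ≡ S ++ ⊥
liftS-++ {n} S = ++-ext (liftS S) S ⊥ left right
  where
  left : ∀ i → lookup (liftS S) (i ↑ˡ 7) ≡ lookup S i
  left i with splitAt n (i ↑ˡ 7) | splitAt-↑ˡ n i 7 | lookup-tabulated (liftS S) refl (i ↑ˡ 7)
  ... | .(inj₁ i) | refl | entry = entry

  right : ∀ j → lookup (liftS S) (n ↑ʳ j) ≡ lookup ⊥ j
  right j with splitAt n (n ↑ʳ j) | splitAt-↑ʳ n 7 j | lookup-tabulated (liftS S) refl (n ↑ʳ j)
  ... | .(inj₂ j) | refl | entry = trans entry (sym (lookup-replicate j outside))

core-singletons : ∀ n → ⁅ x₁ n ⁆ ∪ ⁅ x₂ n ⁆ ∪ ⁅ x₃ n ⁆ ≡ ⊥ {n} ++ core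
core-singletons zero = refl
core-singletons (suc n) = cong (outside ∷_) (core-singletons n)

lifted-code : ∀ {n} (S′ : Subset n) → liftS S′ ∪ ⁅ x₁ n ⁆ ∪ ⁅ x₂ n ⁆ ∪ ⁅ x₃ n ⁆ ≡ S′ ++ core
lifted-code {n} S′ = begin
  liftS S′ ∪ ⁅ x₁ n ⁆ ∪ ⁅ x₂ n ⁆ ∪ ⁅ x₃ n ⁆  ≡⟨ cong₂ _∪_ (liftS-++ S′) (core-singletons n) ⟩
  (S′ ++ ⊥) ∪ (⊥ ++ core)                   ≡⟨ ∪-++ S′ ⊥ ⊥ core ⟩
  (S′ ∪ ⊥) ++ (⊥ ∪ core)                    ≡⟨ cong₂ _++_ (∪-identityʳ S′) (∪-identityˡ core) ⟩
  S′ ++ core                                ∎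

lemma4 : (n : ℕ) (A : Adj n) → Symmetric A → Irreflexive A → (v : Fin n) →
    ((S : Subset (n + 7)) → IsγIDSet (glue A v) S →
        (x₁ n ∈ S) × (x₂ n ∈ S) × (x₃ n ∈ S))
    × ((S' : Subset n) → IsγIDSet A S' →
        IsIdCode (glue A v) (liftS S' ∪ ⁅ x₁ n ⁆ ∪ ⁅ x₂ n ⁆ ∪ ⁅ x₃ n ⁆))
lemma4 n A _ _ v = contains-core , extends
  where
  open Glued A v

  contains-core : ∀ S → IsγIDSet G S → (x₁ n ∈ S) × (x₂ n ∈ S) × (x₃ n ∈ S)
  contains-core S γ with Vec.splitAt n S
  ... | L , R , refl = let core⊆R = core-in-γ-set L R γ in
    ∈-++⁺ʳ {X = L} (core⊆R here) ,
    ∈-++⁺ʳ {X = L} (core⊆R (there here)) ,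
    ∈-++⁺ʳ {X = L} (core⊆R (there (there here)))

  extends : ∀ S′ → IsγIDSet A S′ → IsIdCode G (liftS S′ ∪ ⁅ x₁ n ⁆ ∪ ⁅ x₂ n ⁆ ∪ ⁅ x₃ n ⁆)
  extends S′ (code , _) = subst (IsIdCode G) (sym (lifted-code S′))
    (glue-identifies S′ core (IsIdCode⇒IdentifiesExcept v code) here core-identifies
      λ c clash → core-clash c clash , proj₁ code v)
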